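{- Let $G$ be a finite simple graph such that $\mathrm{corona}(G)\cap\partial_L(G)=\emptyset$. Then the family of maximum critical independent sets of $G$ equals $\{T\cap L(G):T\in\Omega(G)\}$. Consequently, \[ \mathrm{nucleus}(G)=\mathrm{core}(G)\cap L(G)\qquad\text{and}\qquad \mathrm{diadem}(G)=\mathrm{corona}(G)\cap L(G). \]
   Context: For $X\subseteq V(G)$, $N(X)$ is the union of neighborhoods of the vertices of $X$. $\Omega(G)$ is the family of maximum independent sets; $\mathrm{core}(G)=\bigcap\Omega(G)$, $\mathrm{corona}(G)=\bigcup\Omega(G)$. An independent set $I$ is critical if $|I|-|N(I)|\ge|J|-|N(J)|$ for every independent set $J$; a maximum critical independent set is a critical independent set of maximum cardinality among critical independent sets. $\mathrm{nucleus}(G)$ is the intersection of all maximum critical independent sets, and $\mathrm{diadem}(G)$ the union of all critical independent sets. $L(G)$ denotes the set $J\cup N(J)$ for any maximum critical independent set $J$ of $G$ (this set does not depend on the choice of $J$); $L^c(G)=V(G)-L(G)$ and $\partial_L(G)=\{v\in L(G):N(v)\cap L^c(G)\neq\emptyset\}$. -}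

module Defs where

open import Data.Nat using (ℕ; _≤_)
open import Data.Integer using (ℤ; +_; _-_; _≥_)
open import Data.Bool using (Bool; true; false)
open import Data.Fin using (Fin)
open import Data.Fin.Subset using (Subset; _∈_; _∉_; _∪_; _∩_; ∣_∣)
open import Data.Fin.Subset.Properties using (_∈?_)
open import Data.Fin.Properties using (any?)
open import Data.Vec using (tabulate)
open import Data.Product using (Σ; _×_; ∃; _,_)
open import Relation.Nullary using (does)
open import Relation.Nullary.Decidable using (_×-dec_)
open import Relation.Binary.PropositionalEquality using (_≡_)
open import Data.Bool.Properties using () renaming (_≟_ to _≟ᵇ_)

record Graph (n : ℕ) : Set where
  field
    adj    : Fin n → Fin n → Bool
    sym    : ∀ u v → adj u v ≡ adj v u
    loopless : ∀ v → adj v v ≡ false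
open Graph public

module _ {n : ℕ} (G : Graph n) where

  Adj : Fin n → Fin n → Set
  Adj u v = adj G u v ≡ true

  N : Subset n → Subset n
  N X = tabulate (λ v → does (any? (λ u → (u ∈? X) ×-dec (adj G u v ≟ᵇ true))))

  Independent : Subset n → Set
  Independent S = ∀ u v → u ∈ S → v ∈ S → adj G u v ≡ false

  MaxIndependent : Subset n → Set
  MaxIndependent S = Independent S × (∀ J → Independent J → ∣ J ∣ ≤ ∣ S ∣)

  dif : Subset n → ℤ
  dif I = + ∣ I ∣ - + ∣ N I ∣

  Critical : Subset n → Set
  Critical I = Independent I × (∀ J → Independent J → dif I ≥ dif J)

  MaxCritical : Subset n → Set
  MaxCritical I = Critical I × (∀ J → Critical J → ∣ J ∣ ≤ ∣ I ∣)

  core : Fin n → Set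
  core v = ∀ T → MaxIndependent T → v ∈ T

  corona : Fin n → Set
  corona v = Σ (Subset n) (λ T → MaxIndependent T × v ∈ T)

  nucleus : Fin n → Set
  nucleus v = ∀ J → MaxCritical J → v ∈ J

  diadem : Fin n → Set
  diadem v = Σ (Subset n) (λ I → Critical I × v ∈ I)

  -- L(G) = J ∪ N(J) for a (any) maximum critical independent set J
  LSet : Subset n → Subset n
  LSet J = J ∪ N J

  boundary : Subset n → Fin n → Set
  boundary L v = v ∈ L × ∃ (λ u → Adj v u × u ∉ L)

{-# OPTIONS --safe #-}
-- Since |N| is submodular, dif I = |I| − |N(I)| is supermodular, so the union of two critical
-- sets is critical whenever it is independent; hence a maximum critical set contains every
-- critical set that is independent together with it.  A critical set I extends to the maximum
-- independent set I ∪ (T − N(I)) for any maximum independent T (Butenko–Trukhanov).  Conversely,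
-- for T maximum independent, T ∩ L is maximum critical: J₀ ∪ (T − L) is independent, so
-- |J₀| ≤ |T ∩ L|, and the hypothesis keeps N(T ∩ L) inside L, so
-- |T ∩ L| + |N(T ∩ L)| ≤ |L| = |J₀| + |N(J₀)|.  Hence every critical set lies in some T ∩ L,
-- with equality for maximum critical sets, and the three identities follow.
module Submission where

open import Defs
open import Data.Nat using (ℕ)
open import Data.Fin using (Fin)
open import Data.Fin.Subset using (Subset; _∈_; _∩_)
open import Data.Product using (Σ; _×_)
open import Data.Empty using (⊥)
open import Function.Bundles using (_⇔_)
open import Relation.Binary.PropositionalEquality using (_≡_)

open import Data.Bool using (true; false)
open import Data.Bool.Properties using (¬-not; T-≡) renaming (_≟_ to _≟ᵇ_)
open import Data.Empty using (⊥-elim)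
open import Data.Fin.Properties using (all?; any?)
open import Data.Fin.Subset using (_∪_; _─_; _⊆_; _∉_; ∣_∣; Empty; inside; outside)
  renaming (⊥ to ∅)
open import Data.Fin.Subset.Properties
  using (_∈?_; x∈p∪q⁻; x∈p∪q⁺; x∈p∩q⁻; x∈p∩q⁺; p⊆p∪q; q⊆p∪q; p∩q⊆p; p∩q⊆q; p─q⊆p;
         x∈p∧x∉q⇒x∈p─q; p⊆q⇒∣p∣≤∣q∣; p⊂q⇒∣p∣<∣q∣; ⊆-refl; ⊆-trans; ⊆-antisym;
         ∩-comm; Empty-unique; ∣⊥∣≡0; anySubset?; ∣p∣≤n; ∉⊥)
open import Data.Integer as ℤ using (+_; +≤+)
import Data.Integer.Properties as ℤₚ
open import Data.Integer.Tactic.RingSolver using (solve-∀)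
open import Data.Nat using (zero; suc; _+_; _≤_; _<?_)
open import Data.Nat.Properties
  using (+-suc; +-assoc; +-identityʳ; +-cancelˡ-≤; +-cancelʳ-≤; +-mono-≤; +-monoʳ-≤; +-monoˡ-≤;
         +-monoʳ-<; +-commutativeSemigroup; ≤-trans; ≤-reflexive; <-irrefl; <-≤-trans; ≮⇒≥;
         m≤m+n; module ≤-Reasoning)
open import Algebra.Properties.CommutativeSemigroup +-commutativeSemigroup
  using (x∙yz≈y∙xz; xy∙z≈xz∙y)
open import Data.Vec using (_∷_; []; here; there)
open import Data.Vec.Properties using ([]=⇒lookup; lookup⇒[]=; lookup∘tabulate)
open import Data.Product using (_,_; proj₁; proj₂; ∃)
open import Data.Sum using (inj₁; inj₂)
open import Function.Bundles using (Equivalence; mk⇔)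
open import Relation.Nullary using (Dec; yes; no)
open import Relation.Nullary.Decidable
  using (_×-dec_; _→-dec_; decidable-stable; toWitness; dec-true; isYes≗does)
open import Relation.Binary.PropositionalEquality
  using (refl; trans; cong; cong₂; subst; subst₂; module ≡-Reasoning)
  renaming (sym to ≡-sym)

i+k≤j+k⇒i≤j : ∀ {i j} k → i ℤ.+ k ℤ.≤ j ℤ.+ k → i ℤ.≤ j
i+k≤j+k⇒i≤j {i} {j} k i+k≤j+k = begin
  i               ≡⟨ i≡i+k-k i k ⟩
  i ℤ.+ k ℤ.- k   ≤⟨ ℤₚ.+-monoˡ-≤ (ℤ.- k) i+k≤j+k ⟩
  j ℤ.+ k ℤ.- k   ≡⟨ ≡-sym (i≡i+k-k j k) ⟩
  j               ∎
  where
  open ℤₚ.≤-Reasoning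
  i≡i+k-k : ∀ i k → i ≡ i ℤ.+ k ℤ.- k
  i≡i+k-k = solve-∀

[+a-+b]+[+c-+d]≡+[a+c]-+[b+d] : ∀ a b c d →
  (+ a ℤ.- + b) ℤ.+ (+ c ℤ.- + d) ≡ + (a + c) ℤ.- + (b + d)
[+a-+b]+[+c-+d]≡+[a+c]-+[b+d] a b c d = begin
  (+ a ℤ.- + b) ℤ.+ (+ c ℤ.- + d)  ≡⟨ regroup (+ a) (+ b) (+ c) (+ d) ⟩
  (+ a ℤ.+ + c) ℤ.- (+ b ℤ.+ + d)  ≡⟨ ≡-sym (cong₂ ℤ._-_ (ℤₚ.pos-+ a c) (ℤₚ.pos-+ b d)) ⟩
  + (a + c) ℤ.- + (b + d)          ∎
  where
  open ≡-Reasoning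
  regroup : ∀ a b c d → (a ℤ.- b) ℤ.+ (c ℤ.- d) ≡ (a ℤ.+ c) ℤ.- (b ℤ.+ d)
  regroup = solve-∀

[+a-+b]≤[+c-+d]⇔a+d≤c+b : ∀ a b c d → (+ a ℤ.- + b ℤ.≤ + c ℤ.- + d) ⇔ (a + d ≤ c + b)
[+a-+b]≤[+c-+d]⇔a+d≤c+b a b c d =
  mk⇔ (λ h → ℤₚ.drop‿+≤+ (subst₂ ℤ._≤_ shiftˡ shiftʳ (ℤₚ.+-monoˡ-≤ (+ b ℤ.+ + d) h)))
      (λ h → i+k≤j+k⇒i≤j (+ b ℤ.+ + d) (subst₂ ℤ._≤_ (≡-sym shiftˡ) (≡-sym shiftʳ) (+≤+ h)))
  where
  cancelˡ : ∀ x y z → (x ℤ.- y) ℤ.+ (y ℤ.+ z) ≡ x ℤ.+ z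
  cancelˡ = solve-∀
  cancelʳ : ∀ x y z → (x ℤ.- z) ℤ.+ (y ℤ.+ z) ≡ x ℤ.+ y
  cancelʳ = solve-∀
  shiftˡ : (+ a ℤ.- + b) ℤ.+ (+ b ℤ.+ + d) ≡ + (a + d)
  shiftˡ = trans (cancelˡ (+ a) (+ b) (+ d)) (≡-sym (ℤₚ.pos-+ a d))
  shiftʳ : (+ c ℤ.- + d) ℤ.+ (+ b ℤ.+ + d) ≡ + (c + b)
  shiftʳ = trans (cancelʳ (+ c) (+ b) (+ d)) (≡-sym (ℤₚ.pos-+ c b))

x∈p─q⇒x∉q : ∀ {n} (p q : Subset n) {x} → x ∈ p ─ q → x ∉ q
x∈p─q⇒x∉q (_ ∷ p) (_      ∷ q) (there x∈p─q) (there x∈q) = x∈p─q⇒x∉q p q x∈p─q x∈q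
x∈p─q⇒x∉q (_ ∷ p) (inside ∷ q) ()             here

p⊆r∧q⊆r⇒p∪q⊆r : ∀ {n} {p q r : Subset n} → p ⊆ r → q ⊆ r → p ∪ q ⊆ r
p⊆r∧q⊆r⇒p∪q⊆r {p = p} {q} p⊆r q⊆r x∈p∪q with x∈p∪q⁻ p q x∈p∪q
... | inj₁ x∈p = p⊆r x∈p
... | inj₂ x∈q = q⊆r x∈q

p⊆q∧∣q∣≤∣p∣⇒q⊆p : ∀ {n} {p q : Subset n} → p ⊆ q → ∣ q ∣ ≤ ∣ p ∣ → q ⊆ p
p⊆q∧∣q∣≤∣p∣⇒q⊆p {p = p} p⊆q ∣q∣≤∣p∣ {x} x∈q = decidable-stable (x ∈? p)
  (λ x∉p → <-irrefl refl (<-≤-trans (p⊂q⇒∣p∣<∣q∣ (p⊆q , x , x∈q , x∉p)) ∣q∣≤∣p∣))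

∣p∪q∣+∣p∩q∣≡∣p∣+∣q∣ : ∀ {n} (p q : Subset n) → ∣ p ∪ q ∣ + ∣ p ∩ q ∣ ≡ ∣ p ∣ + ∣ q ∣
∣p∪q∣+∣p∩q∣≡∣p∣+∣q∣ []            []            = refl
∣p∪q∣+∣p∩q∣≡∣p∣+∣q∣ (inside ∷ p)  (inside ∷ q)  =
  cong suc (trans (+-suc _ _) (trans (cong suc (∣p∪q∣+∣p∩q∣≡∣p∣+∣q∣ p q)) (≡-sym (+-suc _ _))))
∣p∪q∣+∣p∩q∣≡∣p∣+∣q∣ (inside ∷ p)  (outside ∷ q) = cong suc (∣p∪q∣+∣p∩q∣≡∣p∣+∣q∣ p q)
∣p∪q∣+∣p∩q∣≡∣p∣+∣q∣ (outside ∷ p) (inside ∷ q)  =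
  trans (cong suc (∣p∪q∣+∣p∩q∣≡∣p∣+∣q∣ p q)) (≡-sym (+-suc _ _))
∣p∪q∣+∣p∩q∣≡∣p∣+∣q∣ (outside ∷ p) (outside ∷ q) = ∣p∪q∣+∣p∩q∣≡∣p∣+∣q∣ p q

∣p∣≡∣p∩q∣+∣p─q∣ : ∀ {n} (p q : Subset n) → ∣ p ∣ ≡ ∣ p ∩ q ∣ + ∣ p ─ q ∣
∣p∣≡∣p∩q∣+∣p─q∣ []            []            = refl
∣p∣≡∣p∩q∣+∣p─q∣ (inside ∷ p)  (inside ∷ q)  = cong suc (∣p∣≡∣p∩q∣+∣p─q∣ p q)
∣p∣≡∣p∩q∣+∣p─q∣ (inside ∷ p)  (outside ∷ q) =
  trans (cong suc (∣p∣≡∣p∩q∣+∣p─q∣ p q)) (≡-sym (+-suc _ _))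
∣p∣≡∣p∩q∣+∣p─q∣ (outside ∷ p) (inside ∷ q)  = ∣p∣≡∣p∩q∣+∣p─q∣ p q
∣p∣≡∣p∩q∣+∣p─q∣ (outside ∷ p) (outside ∷ q) = ∣p∣≡∣p∩q∣+∣p─q∣ p q

p⊆q⇒∣q∣≡∣p∣+∣q─p∣ : ∀ {n} {p q : Subset n} → p ⊆ q → ∣ q ∣ ≡ ∣ p ∣ + ∣ q ─ p ∣
p⊆q⇒∣q∣≡∣p∣+∣q─p∣ {p = p} {q} p⊆q =
  trans (∣p∣≡∣p∩q∣+∣p─q∣ q p) (cong (λ r → ∣ r ∣ + ∣ q ─ p ∣) q∩p≡p)
  where
  q∩p≡p : q ∩ p ≡ p
  q∩p≡p = ⊆-antisym (p∩q⊆q q p) (λ x∈p → x∈p∩q⁺ (p⊆q x∈p , x∈p))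

∣p─q∣≤∣q─p∣⇒∣p∣≤∣q∣ : ∀ {n} (p q : Subset n) → ∣ p ─ q ∣ ≤ ∣ q ─ p ∣ → ∣ p ∣ ≤ ∣ q ∣
∣p─q∣≤∣q─p∣⇒∣p∣≤∣q∣ p q ∣p─q∣≤∣q─p∣ = begin
  ∣ p ∣                  ≡⟨ ∣p∣≡∣p∩q∣+∣p─q∣ p q ⟩
  ∣ p ∩ q ∣ + ∣ p ─ q ∣  ≤⟨ +-mono-≤ (≤-reflexive (cong ∣_∣ (∩-comm p q))) ∣p─q∣≤∣q─p∣ ⟩
  ∣ q ∩ p ∣ + ∣ q ─ p ∣  ≡⟨ ≡-sym (∣p∣≡∣p∩q∣+∣p─q∣ q p) ⟩
  ∣ q ∣                  ∎
  where open ≤-Reasoning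

Empty[p∩q]⇒∣p∪q∣≡∣p∣+∣q∣ : ∀ {n} (p q : Subset n) → Empty (p ∩ q) → ∣ p ∪ q ∣ ≡ ∣ p ∣ + ∣ q ∣
Empty[p∩q]⇒∣p∪q∣≡∣p∣+∣q∣ {n} p q p∩q-empty = begin
  ∣ p ∪ q ∣              ≡⟨ ≡-sym (+-identityʳ _) ⟩
  ∣ p ∪ q ∣ + 0          ≡⟨ cong (λ r → ∣ p ∪ q ∣ + r) (≡-sym ∣p∩q∣≡0) ⟩
  ∣ p ∪ q ∣ + ∣ p ∩ q ∣  ≡⟨ ∣p∪q∣+∣p∩q∣≡∣p∣+∣q∣ p q ⟩
  ∣ p ∣ + ∣ q ∣          ∎
  where
  open ≡-Reasoning
  ∣p∩q∣≡0 : ∣ p ∩ q ∣ ≡ 0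
  ∣p∩q∣≡0 = trans (cong ∣_∣ (Empty-unique p∩q-empty)) (∣⊥∣≡0 n)

Empty[p∩q]⇒∣p∣+∣q∣≤∣r∣ : ∀ {n} {p q r : Subset n} → Empty (p ∩ q) → p ⊆ r → q ⊆ r →
                         ∣ p ∣ + ∣ q ∣ ≤ ∣ r ∣
Empty[p∩q]⇒∣p∣+∣q∣≤∣r∣ {p = p} {q} p∩q-empty p⊆r q⊆r =
  subst (_≤ _) (Empty[p∩q]⇒∣p∪q∣≡∣p∣+∣q∣ p q p∩q-empty) (p⊆q⇒∣p∣≤∣q∣ (p⊆r∧q⊆r⇒p∪q⊆r p⊆r q⊆r))

module _ {n : ℕ} (G : Graph n) where

  private
    -- the decision procedure tabulated in the definition of N
    hasNeighbourIn? : ∀ X v → Dec (∃ λ u → u ∈ X × Adj G u v)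
    hasNeighbourIn? X v = any? (λ u → (u ∈? X) ×-dec (adj G u v ≟ᵇ true))

  ∈N⁺ : ∀ {X : Subset n} {u v} → u ∈ X → Adj G u v → v ∈ N G X
  ∈N⁺ {X} {u} {v} u∈X uv = lookup⇒[]= v (N G X)
    (trans (lookup∘tabulate _ v) (dec-true (hasNeighbourIn? X v) (u , u∈X , uv)))

  ∈N⁻ : ∀ {X : Subset n} {v} → v ∈ N G X → ∃ λ u → u ∈ X × Adj G u v
  ∈N⁻ {X} {v} v∈NX = toWitness {a? = hasNeighbourIn? X v} (Equivalence.from T-≡
    (trans (isYes≗does _) (trans (≡-sym (lookup∘tabulate _ v)) ([]=⇒lookup v∈NX))))

  N-mono : ∀ {X Y : Subset n} → X ⊆ Y → N G X ⊆ N G Y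
  N-mono X⊆Y v∈NX = let u , u∈X , uv = ∈N⁻ v∈NX in ∈N⁺ (X⊆Y u∈X) uv

  N-∪ : ∀ (X Y : Subset n) → N G (X ∪ Y) ⊆ N G X ∪ N G Y
  N-∪ X Y v∈N[X∪Y] with ∈N⁻ v∈N[X∪Y]
  ... | u , u∈X∪Y , uv with x∈p∪q⁻ X Y u∈X∪Y
  ...   | inj₁ u∈X = x∈p∪q⁺ (inj₁ (∈N⁺ u∈X uv))
  ...   | inj₂ u∈Y = x∈p∪q⁺ (inj₂ (∈N⁺ u∈Y uv))

  N-∩ : ∀ (X Y : Subset n) → N G (X ∩ Y) ⊆ N G X ∩ N G Y
  N-∩ X Y v∈N[X∩Y] = x∈p∩q⁺ (N-mono (p∩q⊆p X Y) v∈N[X∩Y] , N-mono (p∩q⊆q X Y) v∈N[X∩Y])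

  ∣N∣-submodular : ∀ (X Y : Subset n) → ∣ N G (X ∪ Y) ∣ + ∣ N G (X ∩ Y) ∣ ≤ ∣ N G X ∣ + ∣ N G Y ∣
  ∣N∣-submodular X Y = begin
    ∣ N G (X ∪ Y) ∣ + ∣ N G (X ∩ Y) ∣
      ≤⟨ +-mono-≤ (p⊆q⇒∣p∣≤∣q∣ (N-∪ X Y)) (p⊆q⇒∣p∣≤∣q∣ (N-∩ X Y)) ⟩
    ∣ N G X ∪ N G Y ∣ + ∣ N G X ∩ N G Y ∣
      ≡⟨ ∣p∪q∣+∣p∩q∣≡∣p∣+∣q∣ (N G X) (N G Y) ⟩
    ∣ N G X ∣ + ∣ N G Y ∣
      ∎
    where open ≤-Reasoning

  Independent-⊆ : ∀ {S T : Subset n} → S ⊆ T → Independent G T → Independent G S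
  Independent-⊆ S⊆T iT u v u∈S v∈S = iT u v (S⊆T u∈S) (S⊆T v∈S)

  Independent⇒∉N : ∀ {A T : Subset n} {v} → Independent G T → A ⊆ T → v ∈ T → v ∉ N G A
  Independent⇒∉N iT A⊆T v∈T v∈NA with ∈N⁻ v∈NA
  ... | u , u∈A , uv with trans (≡-sym uv) (iT _ _ (A⊆T u∈A) v∈T)
  ... | ()

  Independent⇒Empty[S∩NS] : ∀ {S : Subset n} → Independent G S → Empty (S ∩ N G S)
  Independent⇒Empty[S∩NS] {S} iS (v , v∈S∩NS) =
    let v∈S , v∈NS = x∈p∩q⁻ S (N G S) v∈S∩NS in Independent⇒∉N iS ⊆-refl v∈S v∈NS

  ∉N⇒nonadjacent : ∀ {S : Subset n} {u v} → u ∈ S → v ∉ N G S → adj G u v ≡ false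
  ∉N⇒nonadjacent u∈S v∉NS = ¬-not (λ uv → v∉NS (∈N⁺ u∈S uv))

  Independent-∪─ : ∀ {S T X : Subset n} → Independent G S → Independent G T → N G S ⊆ X →
                   Independent G (S ∪ (T ─ X))
  Independent-∪─ {S} {T} {X} iS iT NS⊆X u v u∈ v∈
    with x∈p∪q⁻ S (T ─ X) u∈ | x∈p∪q⁻ S (T ─ X) v∈
  ... | inj₁ u∈S   | inj₁ v∈S   = iS u v u∈S v∈S
  ... | inj₁ u∈S   | inj₂ v∈T─X = ∉N⇒nonadjacent u∈S (λ v∈NS → x∈p─q⇒x∉q T X v∈T─X (NS⊆X v∈NS))
  ... | inj₂ u∈T─X | inj₁ v∈S   =
    trans (sym G u v) (∉N⇒nonadjacent v∈S (λ u∈NS → x∈p─q⇒x∉q T X u∈T─X (NS⊆X u∈NS)))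
  ... | inj₂ u∈T─X | inj₂ v∈T─X = iT u v (p─q⊆p T X u∈T─X) (p─q⊆p T X v∈T─X)

  dif-supermodular : ∀ (I J : Subset n) → dif G I ℤ.+ dif G J ℤ.≤ dif G (I ∪ J) ℤ.+ dif G (I ∩ J)
  dif-supermodular I J = begin
    dif G I ℤ.+ dif G J
      ≡⟨ [+a-+b]+[+c-+d]≡+[a+c]-+[b+d] (∣ I ∣) (∣ N G I ∣) (∣ J ∣) (∣ N G J ∣) ⟩
    + (∣ I ∣ + ∣ J ∣) ℤ.- + (∣ N G I ∣ + ∣ N G J ∣)
      ≡⟨ cong (λ m → + m ℤ.- + (∣ N G I ∣ + ∣ N G J ∣)) (≡-sym (∣p∪q∣+∣p∩q∣≡∣p∣+∣q∣ I J)) ⟩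
    + (∣ I ∪ J ∣ + ∣ I ∩ J ∣) ℤ.- + (∣ N G I ∣ + ∣ N G J ∣)
      ≤⟨ ℤₚ.+-monoʳ-≤ (+ (∣ I ∪ J ∣ + ∣ I ∩ J ∣)) (ℤₚ.neg-mono-≤ (+≤+ (∣N∣-submodular I J))) ⟩
    + (∣ I ∪ J ∣ + ∣ I ∩ J ∣) ℤ.- + (∣ N G (I ∪ J) ∣ + ∣ N G (I ∩ J) ∣)
      ≡⟨ ≡-sym ([+a-+b]+[+c-+d]≡+[a+c]-+[b+d]
                 (∣ I ∪ J ∣) (∣ N G (I ∪ J) ∣) (∣ I ∩ J ∣) (∣ N G (I ∩ J) ∣)) ⟩
    dif G (I ∪ J) ℤ.+ dif G (I ∩ J)
      ∎
    where open ℤₚ.≤-Reasoning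

  Critical-∪ : ∀ {I J : Subset n} → Critical G I → Critical G J → Independent G (I ∪ J) →
               Critical G (I ∪ J)
  Critical-∪ {I} {J} (_ , difI-max) (iJ , difJ-max) iI∪J =
    iI∪J , λ K iK → ℤₚ.≤-trans (difI-max K iK) difI≤dif[I∪J]
    where
    difI≤dif[I∪J] : dif G I ℤ.≤ dif G (I ∪ J)
    difI≤dif[I∪J] = i+k≤j+k⇒i≤j (dif G J) (begin
      dif G I ℤ.+ dif G J              ≤⟨ dif-supermodular I J ⟩
      dif G (I ∪ J) ℤ.+ dif G (I ∩ J)  ≤⟨ ℤₚ.+-monoʳ-≤ (dif G (I ∪ J)) difI∩J≤difJ ⟩
      dif G (I ∪ J) ℤ.+ dif G J        ∎)
      where
      open ℤₚ.≤-Reasoning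
      difI∩J≤difJ : dif G (I ∩ J) ℤ.≤ dif G J
      difI∩J≤difJ = difJ-max (I ∩ J) (Independent-⊆ (p∩q⊆q I J) iJ)

  MaxCritical-absorbs : ∀ {I S : Subset n} → Critical G I → MaxCritical G S →
                        Independent G (I ∪ S) → I ⊆ S
  MaxCritical-absorbs {I} {S} cI (cS , S-largest) iI∪S =
    ⊆-trans (p⊆p∪q S) (p⊆q∧∣q∣≤∣p∣⇒q⊆p (q⊆p∪q I S) (S-largest (I ∪ S) (Critical-∪ cI cS iI∪S)))

  Critical⇒∣NS─NA∣≤∣S─A∣ : ∀ {S A : Subset n} → Critical G S → A ⊆ S →
                           ∣ N G S ─ N G A ∣ ≤ ∣ S ─ A ∣
  Critical⇒∣NS─NA∣≤∣S─A∣ {S} {A} (iS , difS-max) A⊆S = +-cancelˡ-≤ (∣ A ∣ + ∣ N G A ∣) _ _ (begin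
    (∣ A ∣ + ∣ N G A ∣) + ∣ N G S ─ N G A ∣  ≡⟨ +-assoc (∣ A ∣) _ _ ⟩
    ∣ A ∣ + (∣ N G A ∣ + ∣ N G S ─ N G A ∣)  ≡⟨ cong (_+_ ∣ A ∣) (≡-sym ∣NS∣≡∣NA∣+∣NS─NA∣) ⟩
    ∣ A ∣ + ∣ N G S ∣                         ≤⟨ difA≤difS ⟩
    ∣ S ∣ + ∣ N G A ∣                         ≡⟨ cong (_+ ∣ N G A ∣) (p⊆q⇒∣q∣≡∣p∣+∣q─p∣ A⊆S) ⟩
    (∣ A ∣ + ∣ S ─ A ∣) + ∣ N G A ∣           ≡⟨ xy∙z≈xz∙y (∣ A ∣) _ _ ⟩
    (∣ A ∣ + ∣ N G A ∣) + ∣ S ─ A ∣           ∎)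
    where
    open ≤-Reasoning
    difA≤difS : ∣ A ∣ + ∣ N G S ∣ ≤ ∣ S ∣ + ∣ N G A ∣
    difA≤difS = Equivalence.to ([+a-+b]≤[+c-+d]⇔a+d≤c+b (∣ A ∣) (∣ N G A ∣) (∣ S ∣) (∣ N G S ∣))
      (difS-max A (Independent-⊆ A⊆S iS))
    ∣NS∣≡∣NA∣+∣NS─NA∣ : ∣ N G S ∣ ≡ ∣ N G A ∣ + ∣ N G S ─ N G A ∣
    ∣NS∣≡∣NA∣+∣NS─NA∣ = p⊆q⇒∣q∣≡∣p∣+∣q─p∣ (N-mono A⊆S)

  -- Butenko–Trukhanov.  U trades T ∩ N(S) for S − T, and criticality of S against S ∩ T
  -- makes the first no larger than the second.
  Critical∪MaxIndependent : ∀ {S T : Subset n} → Critical G S → MaxIndependent G T →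
                            MaxIndependent G (S ∪ (T ─ N G S))
  Critical∪MaxIndependent {S} {T} cS@(iS , _) (iT , T-largest) =
    Independent-∪─ iS iT ⊆-refl ,
    λ J iJ → ≤-trans (T-largest J iJ) (∣p─q∣≤∣q─p∣⇒∣p∣≤∣q∣ T U ∣T─U∣≤∣U─T∣)
    where
    U A : Subset n
    U = S ∪ (T ─ N G S)
    A = S ∩ T
    T─U⊆NS─NA : T ─ U ⊆ N G S ─ N G A
    T─U⊆NS─NA {x} x∈T─U = x∈p∧x∉q⇒x∈p─q x∈NS (Independent⇒∉N iT (p∩q⊆q S T) x∈T)
      where
      x∈T = p─q⊆p T U x∈T─U
      x∈NS = decidable-stable (x ∈? N G S) λ x∉NS →
        x∈p─q⇒x∉q T U x∈T─U (q⊆p∪q S (T ─ N G S) (x∈p∧x∉q⇒x∈p─q x∈T x∉NS))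
    S─A⊆U─T : S ─ A ⊆ U ─ T
    S─A⊆U─T {x} x∈S─A = x∈p∧x∉q⇒x∈p─q (p⊆p∪q (T ─ N G S) x∈S)
                                        (λ x∈T → x∈p─q⇒x∉q S A x∈S─A (x∈p∩q⁺ (x∈S , x∈T)))
      where x∈S = p─q⊆p S A x∈S─A
    ∣T─U∣≤∣U─T∣ : ∣ T ─ U ∣ ≤ ∣ U ─ T ∣
    ∣T─U∣≤∣U─T∣ = begin
      ∣ T ─ U ∣              ≤⟨ p⊆q⇒∣p∣≤∣q∣ T─U⊆NS─NA ⟩
      ∣ N G S ─ N G A ∣      ≤⟨ Critical⇒∣NS─NA∣≤∣S─A∣ cS (p∩q⊆p S T) ⟩
      ∣ S ─ A ∣              ≤⟨ p⊆q⇒∣p∣≤∣q∣ S─A⊆U─T ⟩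
      ∣ U ─ T ∣              ∎
      where open ≤-Reasoning

  Independent? : ∀ S → Dec (Independent G S)
  Independent? S = all? λ u → all? λ v → (u ∈? S) →-dec (v ∈? S) →-dec (adj G u v ≟ᵇ false)

  maxIndependent : Σ (Subset n) (MaxIndependent G)
  maxIndependent = grow n ∅ (λ u v u∈∅ → ⊥-elim (∉⊥ u∈∅)) (m≤m+n n _)
    where
    -- every round strictly enlarges S, and ∣ S ∣ ≤ n, so k rounds of fuel suffice
    grow : ∀ k S → Independent G S → n ≤ k + ∣ S ∣ → Σ (Subset n) (MaxIndependent G)
    grow zero    S iS n≤∣S∣ = S , iS , λ J _ → ≤-trans (∣p∣≤n J) n≤∣S∣
    grow (suc k) S iS n≤1+k+∣S∣ with anySubset? (λ J → Independent? J ×-dec (∣ S ∣ <? ∣ J ∣))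
    ... | yes (J , iJ , ∣S∣<∣J∣) = grow k J iJ (≤-trans n≤1+k+∣S∣ (+-monoʳ-< k ∣S∣<∣J∣))
    ... | no no-larger          = S , iS , λ J iJ → ≮⇒≥ (λ ∣S∣<∣J∣ → no-larger (J , iJ , ∣S∣<∣J∣))

  ∣LSet∣≡∣J∣+∣NJ∣ : ∀ {J : Subset n} → Independent G J → ∣ LSet G J ∣ ≡ ∣ J ∣ + ∣ N G J ∣
  ∣LSet∣≡∣J∣+∣NJ∣ {J} iJ = Empty[p∩q]⇒∣p∪q∣≡∣p∣+∣q∣ J (N G J) (Independent⇒Empty[S∩NS] iJ)

  ∣J∣≤∣T∩LSet∣ : ∀ {J T : Subset n} → Independent G J → MaxIndependent G T →
                 ∣ J ∣ ≤ ∣ T ∩ LSet G J ∣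
  ∣J∣≤∣T∩LSet∣ {J} {T} iJ (iT , T-largest) = +-cancelʳ-≤ (∣ T ─ L ∣) _ _ (begin
    ∣ J ∣ + ∣ T ─ L ∣          ≡⟨ ≡-sym (Empty[p∩q]⇒∣p∪q∣≡∣p∣+∣q∣ J (T ─ L) J∩[T─L]-empty) ⟩
    ∣ J ∪ (T ─ L) ∣            ≤⟨ T-largest _ (Independent-∪─ iJ iT (q⊆p∪q J (N G J))) ⟩
    ∣ T ∣                      ≡⟨ ∣p∣≡∣p∩q∣+∣p─q∣ T L ⟩
    ∣ T ∩ L ∣ + ∣ T ─ L ∣      ∎)
    where
    open ≤-Reasoning
    L = LSet G J
    J∩[T─L]-empty : Empty (J ∩ (T ─ L))
    J∩[T─L]-empty (v , v∈) = let v∈J , v∈T─L = x∈p∩q⁻ J (T ─ L) v∈ in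
      x∈p─q⇒x∉q T L v∈T─L (p⊆p∪q (N G J) v∈J)

  MaxCritical-≤ : ∀ {J S : Subset n} → MaxCritical G J → Independent G S → ∣ J ∣ ≤ ∣ S ∣ →
                  ∣ S ∣ + ∣ N G S ∣ ≤ ∣ J ∣ + ∣ N G J ∣ → MaxCritical G S
  MaxCritical-≤ {J} {S} ((_ , difJ-max) , J-largest) iS ∣J∣≤∣S∣ ∣S∣+∣NS∣≤∣J∣+∣NJ∣ =
    (iS , λ K iK → ℤₚ.≤-trans (difJ-max K iK) difJ≤difS) ,
    λ K cK → ≤-trans (J-largest K cK) ∣J∣≤∣S∣
    where
    difJ≤difS : dif G J ℤ.≤ dif G S
    difJ≤difS = Equivalence.from ([+a-+b]≤[+c-+d]⇔a+d≤c+b (∣ J ∣) (∣ N G J ∣) (∣ S ∣) (∣ N G S ∣))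
      (+-cancelˡ-≤ (∣ S ∣) _ _ (begin
        ∣ S ∣ + (∣ J ∣ + ∣ N G S ∣)  ≡⟨ x∙yz≈y∙xz (∣ S ∣) (∣ J ∣) (∣ N G S ∣) ⟩
        ∣ J ∣ + (∣ S ∣ + ∣ N G S ∣)  ≤⟨ +-monoʳ-≤ (∣ J ∣) ∣S∣+∣NS∣≤∣J∣+∣NJ∣ ⟩
        ∣ J ∣ + (∣ J ∣ + ∣ N G J ∣)  ≤⟨ +-mono-≤ ∣J∣≤∣S∣ (+-monoˡ-≤ (∣ N G J ∣) ∣J∣≤∣S∣) ⟩
        ∣ S ∣ + (∣ S ∣ + ∣ N G J ∣)  ∎))
      where open ≤-Reasoning

module CoronaDisjointFromBoundary
  {n : ℕ} (G : Graph n) (J₀ : Subset n) (mcJ₀ : MaxCritical G J₀)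
  (corona∩∂L≡∅ : ∀ v → corona G v → boundary G (LSet G J₀) v → ⊥) where

  L : Subset n
  L = LSet G J₀

  N[T∩L]⊆L : ∀ {T} → MaxIndependent G T → N G (T ∩ L) ⊆ L
  N[T∩L]⊆L {T} mT {v} v∈N[T∩L] = decidable-stable (v ∈? L) λ v∉L →
    let u , u∈T∩L , uv = ∈N⁻ G v∈N[T∩L]
        u∈T , u∈L      = x∈p∩q⁻ T L u∈T∩L
    in corona∩∂L≡∅ u (T , mT , u∈T) (u∈L , v , uv , v∉L)

  MaxIndependent⇒MaxCritical[T∩L] : ∀ {T} → MaxIndependent G T → MaxCritical G (T ∩ L)
  MaxIndependent⇒MaxCritical[T∩L] {T} mT@(iT , _) =
    MaxCritical-≤ G mcJ₀ iT∩L (∣J∣≤∣T∩LSet∣ G iJ₀ mT) (begin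
      ∣ T ∩ L ∣ + ∣ N G (T ∩ L) ∣  ≤⟨ Empty[p∩q]⇒∣p∣+∣q∣≤∣r∣ (Independent⇒Empty[S∩NS] G iT∩L)
                                                              (p∩q⊆q T L) (N[T∩L]⊆L mT) ⟩
      ∣ L ∣                         ≡⟨ ∣LSet∣≡∣J∣+∣NJ∣ G iJ₀ ⟩
      ∣ J₀ ∣ + ∣ N G J₀ ∣           ∎)
    where
    open ≤-Reasoning
    iJ₀ : Independent G J₀
    iJ₀ = proj₁ (proj₁ mcJ₀)
    iT∩L : Independent G (T ∩ L)
    iT∩L = Independent-⊆ G (p∩q⊆p T L) iT

  Critical⇒⊆MaxIndependent∩L : ∀ {I} → Critical G I →
                               Σ (Subset n) (λ T → MaxIndependent G T × I ⊆ T ∩ L)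
  Critical⇒⊆MaxIndependent∩L {I} cI =
    T , mT , MaxCritical-absorbs G cI (MaxIndependent⇒MaxCritical[T∩L] mT) iI∪[T∩L]
    where
    T : Subset n
    T = I ∪ (proj₁ (maxIndependent G) ─ N G I)
    mT : MaxIndependent G T
    mT = Critical∪MaxIndependent G cI (proj₂ (maxIndependent G))
    iI∪[T∩L] : Independent G (I ∪ (T ∩ L))
    iI∪[T∩L] = Independent-⊆ G (p⊆r∧q⊆r⇒p∪q⊆r (p⊆p∪q _) (p∩q⊆p T L)) (proj₁ mT)

  MaxCritical⇒≡MaxIndependent∩L : ∀ {S} → MaxCritical G S →
                                  Σ (Subset n) (λ T → MaxIndependent G T × S ≡ T ∩ L)
  MaxCritical⇒≡MaxIndependent∩L {S} mcS@(cS , _) =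
    let T , mT , S⊆T∩L = Critical⇒⊆MaxIndependent∩L cS
        T∩L⊆T           = p∩q⊆p T L
        iT∩L∪S          = Independent-⊆ G (p⊆r∧q⊆r⇒p∪q⊆r T∩L⊆T (⊆-trans S⊆T∩L T∩L⊆T)) (proj₁ mT)
        cT∩L            = proj₁ (MaxIndependent⇒MaxCritical[T∩L] mT)
    in T , mT , ⊆-antisym S⊆T∩L (MaxCritical-absorbs G cT∩L mcS iT∩L∪S)

mainTheorem7 : ∀ {n : ℕ} (G : Graph n) (J₀ : Subset n) → MaxCritical G J₀ →
    (∀ v → corona G v → boundary G (LSet G J₀) v → ⊥) →
    (∀ S → MaxCritical G S ⇔ Σ (Subset n) (λ T → MaxIndependent G T × S ≡ T ∩ LSet G J₀))
    × (∀ v → nucleus G v ⇔ (core G v × v ∈ LSet G J₀))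
    × (∀ v → diadem G v ⇔ (corona G v × v ∈ LSet G J₀))
mainTheorem7 G J₀ mcJ₀ corona∩∂L≡∅ =
    (λ S → mk⇔ MaxCritical⇒≡MaxIndependent∩L
                λ { (T , mT , refl) → MaxIndependent⇒MaxCritical[T∩L] mT })
  , (λ v → mk⇔
      (λ v∈nucleus → (λ T mT → p∩q⊆p T L (v∈nucleus (T ∩ L) (MaxIndependent⇒MaxCritical[T∩L] mT)))
                    , p⊆p∪q (N G J₀) (v∈nucleus J₀ mcJ₀))
      (λ (v∈core , v∈L) S mcS → let T , mT , S≡T∩L = MaxCritical⇒≡MaxIndependent∩L mcS in
        subst (v ∈_) (≡-sym S≡T∩L) (x∈p∩q⁺ (v∈core T mT , v∈L))))
  , (λ v → mk⇔
      (λ (I , cI , v∈I) → let T , mT , I⊆T∩L = Critical⇒⊆MaxIndependent∩L cI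
                              v∈T , v∈L     = x∈p∩q⁻ T L (I⊆T∩L v∈I)
                          in (T , mT , v∈T) , v∈L)
      (λ ((T , mT , v∈T) , v∈L) →
        T ∩ L , proj₁ (MaxIndependent⇒MaxCritical[T∩L] mT) , x∈p∩q⁺ (v∈T , v∈L)))
  where open CoronaDisjointFromBoundary G J₀ mcJ₀ corona∩∂L≡∅
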